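{- If the statement $\Phi_5$ holds, then there are infinitely many twin primes, i.e. infinitely many primes $p$ such that $p-2$ or $p+2$ is also prime.
   Context: Define $f:\{1,2,3,\ldots\}\to\mathbb{N}$ by $f(1)=2$, $f(2)=3$, and $f(n+1)=f(n)!$ for every integer $n\geqslant 2$. Write $x\not\mid y$ to mean that $x$ does not divide $y$. For a positive integer $n$, $\Phi_n$ denotes the statement: for every system $\mathcal{S}$ that is a subset of $\{x_i+1=x_k,\ x_i!=x_k,\ x_i\not\mid x_k : i,k\in\{1,\ldots,n\}\}$, if $\mathcal{S}$ has only finitely many solutions in positive integers $x_1,\ldots,x_n$, then every such solution $(x_1,\ldots,x_n)$ satisfies $x_1,\ldots,x_n\leqslant f(n)$. -}

module Defs where

open import Data.Nat using (ℕ; zero; suc; _+_; _!; _≤_; _∸_)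
open import Data.Nat.Divisibility using (_∣_)
open import Data.Nat.Primality using (Prime)
open import Data.Fin using (Fin)
open import Data.Vec using (Vec; lookup)
open import Data.List using (List)
open import Data.List.Relation.Unary.All using (All)
open import Data.Product using (∃; _×_)
open import Data.Sum using (_⊎_)
open import Relation.Nullary using (¬_)
open import Relation.Binary.PropositionalEquality using (_≡_)
import Data.Vec.Relation.Unary.All as VAll
import Data.List.Membership.Propositional as LMem

-- f(1) = 2, f(2) = 3, f(n+1) = f(n)! for n ≥ 2.
-- The value at 0 is irrelevant (f is only used at positive arguments).
f : ℕ → ℕ
f zero = 0
f (suc zero) = 2
f (suc (suc zero)) = 3
f (suc (suc (suc n))) = f (suc (suc n)) !

data Equation (n : ℕ) : Set where
  succEq : Fin n → Fin n → Equation n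
  factEq : Fin n → Fin n → Equation n
  ndivEq : Fin n → Fin n → Equation n

-- A (finite) system is a subset of the finite set of atomic equations,
-- represented as a list of equations.
System : ℕ → Set
System n = List (Equation n)

Satisfies : ∀ {n} → Vec ℕ n → Equation n → Set
Satisfies x (succEq i k) = lookup x i + 1 ≡ lookup x k
Satisfies x (factEq i k) = (lookup x i) ! ≡ lookup x k
Satisfies x (ndivEq i k) = ¬ (lookup x i ∣ lookup x k)

Positive : ℕ → Set
Positive m = 1 ≤ m

Solution : ∀ {n} → System n → Vec ℕ n → Set
Solution S x = VAll.All Positive x × All (Satisfies x) S

Finite : {A : Set} → (A → Set) → Set
Finite {A} P = ∃ λ (L : List A) → ∀ a → P a → a LMem.∈ L

Infinite : {A : Set} → (A → Set) → Set
Infinite P = ¬ Finite P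

Φ : ℕ → Set
Φ n = (S : System n) → Finite (Solution S) →
      (x : Vec ℕ n) → Solution S x → VAll.All (λ xi → xi ≤ f n) x

TwinPrime : ℕ → Set
TwinPrime p = Prime p × (Prime (p ∸ 2) ⊎ Prime (p + 2))

module Submission where

-- Consider the system 𝒮 in five unknowns
--     x₂ = x₁ + 1,  x₃ = x₂ + 1,  x₄ = x₃ + 1,  x₅ = x₁!,  x₂ ∤ x₅,  x₄ ∤ x₅ .
-- Its positive solutions are exactly (a, a+1, a+2, a+3, a!) with a+1 ∤ a! and
-- a+3 ∤ a!.  By a Wilson-type criterion (a number n ≥ 2, n ≠ 4, with
-- n ≤ m + 3 and n ∤ m! is prime) this forces either a = 1 or both a+1 and
-- a+3 prime.  Hence finitely many twin primes would give 𝒮 finitely many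
-- solutions, and Φ₅ would bound them by f(5) = 720!.  But a = 808 is a
-- solution (809 and 811 are primes) whose last entry 808! exceeds 720!.

open import Defs
open import Data.Nat using (ℕ; zero; suc; _+_; _*_; _!; _≤_; _<_; _∸_; z≤n; s≤s; _<?_)
open import Data.Nat.Properties
open import Data.Nat.Divisibility
open import Data.Nat.Primality
open import Data.Nat.Base using (n>1⇒nonTrivial; nonTrivial⇒n>1)
open import Data.Fin using (Fin; #_)
open import Data.Vec using (Vec; []; _∷_)
open import Data.List using ([]; _∷_; map)
open import Data.List.Relation.Unary.All using ([]; _∷_)
import Data.Vec.Relation.Unary.All as VAll
open import Data.List.Relation.Unary.Any using (here; there)
open import Data.List.Membership.Propositional using (_∈_)
open import Data.List.Membership.Propositional.Properties using (∈-map⁺)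
open import Data.Product using (∃; _×_; _,_)
open import Data.Sum using (_⊎_; inj₁; inj₂)
open import Data.Empty using (⊥-elim)
open import Relation.Nullary using (¬_)
open import Relation.Nullary.Decidable using (from-yes)
open import Relation.Binary.PropositionalEquality using (_≡_; _≢_; refl; sym; trans; cong; subst)

prime∤! : ∀ {p} → Prime p → ∀ m → m < p → ¬ p ∣ m !
prime∤! pp zero _ p∣1 = ¬prime[1] (subst Prime (∣1⇒≡1 p∣1) pp)
prime∤! pp (suc m) m<p p∣m! with euclidsLemma (suc m) (m !) pp p∣m!
... | inj₁ p∣1+m = <⇒≱ m<p (∣⇒≤ p∣1+m)
... | inj₂ p∣m!′ = prime∤! pp m (<-trans (n<1+n m) m<p) p∣m!′

!-mono-< : ∀ {m n} → 1 ≤ m → m < n → m ! < n !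
!-mono-< {m} {suc n} 1≤m (s≤s m≤n) = begin-strict
  m !          ≤⟨ ∣⇒≤ {{n !≢0}} (m≤n⇒m!∣n! m≤n) ⟩
  n !          <⟨ m<m*n (n !) (suc n) {{n !≢0}} (s≤s (≤-trans 1≤m m≤n)) ⟩
  n ! * suc n  ≡⟨ *-comm (n !) (suc n) ⟩
  suc n !      ∎
  where open ≤-Reasoning

n∣n! : ∀ {n} → 1 ≤ n → n ∣ n !
n∣n! {suc n} _ = m∣m*n (n !)

3≤d-unless-2*2 : ∀ {d} → 2 ≤ d → d * d ≢ 4 → 3 ≤ d
3≤d-unless-2*2 {1} (s≤s ()) _
3≤d-unless-2*2 {2} _ 2*2≢4 = ⊥-elim (2*2≢4 refl)
3≤d-unless-2*2 {suc (suc (suc _))} _ _ = s≤s (s≤s (s≤s z≤n))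

-- For 1 ≤ d < e both d and e occur as distinct factors of e!, so d·e ∣ e!.
*∣! : ∀ {d e} → 1 ≤ d → d < e → d * e ∣ e !
*∣! {d} {suc e} 1≤d (s≤s d≤e) =
  subst (_∣ suc e !) (*-comm (suc e) d)
    (*-monoʳ-∣ (suc e) (∣-trans (n∣n! 1≤d) (m≤n⇒m!∣n! d≤e)))

cancel-3 : ∀ {k n m} → k + 3 ≤ n → n ≤ m + 3 → k ≤ m
cancel-3 {k} {n} {m} k+3≤n n≤m+3 = +-cancelʳ-≤ 3 k m (≤-trans k+3≤n n≤m+3)

-- A product d·e with 2 ≤ d ≤ e, other than 2·2, divides m! as soon as
-- d·e ≤ m + 3.  For d < e use d·e ∣ e! with e + 3 ≤ 2e ≤ d·e; for d = e ≥ 3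
-- use d·d ∣ d·(2d) ∣ (2d)! with 2d + 3 ≤ 3d ≤ d·d.
ordered-product∣! : ∀ {d e m} → 2 ≤ d → d ≤ e → d * e ≢ 4 → d * e ≤ m + 3 → d * e ∣ m !
ordered-product∣! {d} {e} {m} 2≤d d≤e de≢4 de≤m+3 with m≤n⇒m<n∨m≡n d≤e
... | inj₁ d<e = ∣-trans (*∣! (≤-trans (s≤s z≤n) 2≤d) d<e) (m≤n⇒m!∣n! e≤m)
  where
  e+3≤de : e + 3 ≤ d * e
  e+3≤de = begin
    e + 3        ≤⟨ +-monoʳ-≤ e (≤-trans (s≤s 2≤d) d<e) ⟩
    e + e        ≡⟨ cong (e +_) (sym (+-identityʳ e)) ⟩
    e + (e + 0)  ≤⟨ *-monoˡ-≤ e 2≤d ⟩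
    d * e        ∎
    where open ≤-Reasoning
  e≤m : e ≤ m
  e≤m = cancel-3 e+3≤de de≤m+3
... | inj₂ refl = ∣-trans d*d∣d*2d (∣-trans (*∣! 1≤d (m<m+n d 1≤d)) (m≤n⇒m!∣n! 2d≤m))
  where
  1≤d : 1 ≤ d
  1≤d = ≤-trans (s≤s z≤n) 2≤d
  3≤d : 3 ≤ d
  3≤d = 3≤d-unless-2*2 2≤d de≢4
  d*d∣d*2d : d * d ∣ d * (d + d)
  d*d∣d*2d = *-monoʳ-∣ d (∣m∣n⇒∣m+n ∣-refl ∣-refl)
  2d+3≤dd : (d + d) + 3 ≤ d * d
  2d+3≤dd = begin
    (d + d) + 3        ≤⟨ +-monoʳ-≤ (d + d) 3≤d ⟩
    (d + d) + d        ≡⟨ trans (+-assoc d d d) (cong (λ z → d + (d + z)) (sym (+-identityʳ d))) ⟩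
    d + (d + (d + 0))  ≤⟨ *-monoˡ-≤ d 3≤d ⟩
    d * d              ∎
    where open ≤-Reasoning
  2d≤m : d + d ≤ m
  2d≤m = cancel-3 2d+3≤dd de≤m+3

product∣! : ∀ {d e m} → 2 ≤ d → 2 ≤ e → d * e ≢ 4 → d * e ≤ m + 3 → d * e ∣ m !
product∣! {d} {e} {m} 2≤d 2≤e de≢4 de≤m+3 with ≤-total d e
... | inj₁ d≤e = ordered-product∣! 2≤d d≤e de≢4 de≤m+3
... | inj₂ e≤d = subst (_∣ m !) (*-comm e d)
  (ordered-product∣! 2≤e e≤d (λ ed≡4 → de≢4 (trans (*-comm d e) ed≡4))
    (subst (_≤ m + 3) (*-comm d e) de≤m+3))

-- Wilson-type primality criterion: n ≥ 2, n ≠ 4, n ≤ m + 3 and n ∤ m!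
-- imply that n is prime, since a composite n = q·d divides m! by product∣!.
∤!⇒prime : ∀ {n m} → 2 ≤ n → n ≢ 4 → n ≤ m + 3 → ¬ n ∣ m ! → Prime n
∤!⇒prime {n} {m} 2≤n n≢4 n≤m+3 n∤m! = ¬composite⇒prime {{n>1⇒nonTrivial 2≤n}} ¬composite
  where
  ¬composite : ¬ Composite n
  ¬composite (hasNonTrivialDivisor {d} d<n d∣n) =
    n∤m! (subst (_∣ m !) (sym n≡qd)
      (product∣! (quotient>1 d∣n d<n) (nonTrivial⇒n>1 d)
        (λ qd≡4 → n≢4 (trans n≡qd qd≡4)) (subst (_≤ m + 3) n≡qd n≤m+3)))
    where
    n≡qd : n ≡ quotient d∣n * d
    n≡qd = m∣n⇒n≡quotient*m d∣n

-- If a ≥ 2 and neither a+1 nor a+3 divides a!, then a+1 and a+3 are twin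
-- primes.  (a = 3 is excluded automatically: 6 ∣ 3!.)
twin-from-∤! : ∀ a → 2 ≤ a → ¬ a + 1 ∣ a ! → ¬ a + 1 + 1 + 1 ∣ a ! → TwinPrime (a + 1)
twin-from-∤! a 2≤a a+1∤a! a+3∤a! = a+1-prime , inj₂ a+3-prime
  where
  a≢3 : a ≢ 3
  a≢3 refl = a+3∤a! ∣-refl
  a+1-prime : Prime (a + 1)
  a+1-prime = ∤!⇒prime (≤-trans 2≤a (m≤m+n a 1)) (λ a+1≡4 → a≢3 (+-cancelʳ-≡ 1 a 3 a+1≡4))
    (+-monoʳ-≤ a (s≤s z≤n)) a+1∤a!
  a+3≡a+1+2 : a + 1 + 1 + 1 ≡ a + 1 + 2
  a+3≡a+1+2 = +-assoc (a + 1) 1 1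
  a+3-prime : Prime (a + 1 + 2)
  a+3-prime = ∤!⇒prime (≤-trans 2≤a (≤-trans (m≤m+n a 1) (m≤m+n (a + 1) 2)))
    (λ a+3≡4 → <⇒≢ 2≤a (sym (+-cancelʳ-≡ 1 a 1 (+-cancelʳ-≡ 2 (a + 1) 2 a+3≡4))))
    (≤-reflexive (+-assoc a 1 2)) (subst (λ k → ¬ k ∣ a !) a+3≡a+1+2 a+3∤a!)

twinSystem : System 5
twinSystem =
  succEq x₁ x₂ ∷ succEq x₂ x₃ ∷ succEq x₃ x₄ ∷ factEq x₁ x₅ ∷ ndivEq x₂ x₅ ∷ ndivEq x₄ x₅ ∷ []
  where
  x₁ x₂ x₃ x₄ x₅ : Fin 5
  x₁ = # 0
  x₂ = # 1
  x₃ = # 2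
  x₄ = # 3
  x₅ = # 4

twinVector : ℕ → Vec ℕ 5
twinVector a = a ∷ a + 1 ∷ a + 1 + 1 ∷ a + 1 + 1 + 1 ∷ a ! ∷ []

solution-shape : ∀ x → Solution twinSystem x →
                 ∃ λ a → x ≡ twinVector a × (a ≡ 1 ⊎ TwinPrime (a + 1))
solution-shape (zero ∷ _ ∷ _ ∷ _ ∷ _ ∷ []) (VAll._∷_ () _ , _)
solution-shape (1 ∷ _ ∷ _ ∷ _ ∷ _ ∷ []) (_ , refl ∷ refl ∷ refl ∷ refl ∷ _) = 1 , refl , inj₁ refl
solution-shape (suc (suc c) ∷ _ ∷ _ ∷ _ ∷ _ ∷ []) (_ , refl ∷ refl ∷ refl ∷ refl ∷ a+1∤a! ∷ a+3∤a! ∷ []) =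
  suc (suc c) , refl , inj₂ (twin-from-∤! (suc (suc c)) (s≤s (s≤s z≤n)) a+1∤a! a+3∤a!)

finiteTwins⇒finiteSolutions : Finite TwinPrime → Finite (Solution twinSystem)
finiteTwins⇒finiteSolutions (twins , complete) = twinVector 1 ∷ map vectorOf twins , listed
  where
  vectorOf : ℕ → Vec ℕ 5
  vectorOf p = twinVector (p ∸ 1)
  listed : ∀ x → Solution twinSystem x → x ∈ twinVector 1 ∷ map vectorOf twins
  listed x sol with solution-shape x sol
  ... | _ , refl , inj₁ refl = here refl
  ... | a , refl , inj₂ twin = there (subst (λ b → twinVector b ∈ map vectorOf twins)
          (m+n∸n≡m a 1) (∈-map⁺ vectorOf (complete (a + 1) twin)))

solution808 : Solution twinSystem (twinVector 808)
solution808 =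
  (s≤s z≤n VAll.∷ s≤s z≤n VAll.∷ s≤s z≤n VAll.∷ s≤s z≤n VAll.∷ 1≤n! 808 VAll.∷ VAll.[]) ,
  (refl ∷ refl ∷ refl ∷ refl ∷ prime∤! prime809 808 (n<1+n 808)
                             ∷ prime∤! prime811 808 (m<m+n 808 (s≤s z≤n)) ∷ [])
  where
  prime809 : Prime 809
  prime809 = from-yes (prime? 809)
  prime811 : Prime 811
  prime811 = from-yes (prime? 811)

f5<808! : f 5 < 808 !
f5<808! = !-mono-< (s≤s z≤n) (from-yes (720 <? 808))

theorem4 : Φ 5 → Infinite TwinPrime
theorem4 Φ₅ finiteTwins = <⇒≱ f5<808! (lastBound bounds)
  where
  bounds : VAll.All (_≤ f 5) (twinVector 808)
  bounds = Φ₅ twinSystem (finiteTwins⇒finiteSolutions finiteTwins) (twinVector 808) solution808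
  lastBound : VAll.All (_≤ f 5) (twinVector 808) → 808 ! ≤ f 5
  lastBound (_ VAll.∷ _ VAll.∷ _ VAll.∷ _ VAll.∷ bound VAll.∷ VAll.[]) = bound
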